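{- Let $H=(U,(A_1,\dots,A_m))$ be a harmonic set system with $|U|<m(m-2)$ and $m\ge 51$. Then $A_1\cap A_3\cap A_5\cap(U\setminus A_7)\cap(U\setminus A_9)\cap(U\setminus A_{11})=\varnothing$.
   Context: A set system is $H=(U,(A_1,\dots,A_m))$ with $A_i\subseteq U$. For $I\subseteq[m]$, $H_I=\bigcap_{i\in I}A_i$ ($=U$ if $I=\varnothing$). The run decomposition of a finite set $I$ of positive integers is the partition formed by the sizes, sorted nonincreasingly, of the maximal runs of consecutive integers in $I$. $H$ is harmonic if $|H_I|=|H_J|$ whenever $I,J\subseteq[m]$ have the same run decomposition. -}

module Defs where

open import Data.Nat using (ℕ; zero; suc)
open import Data.Nat.Properties using (≤-decTotalOrder)
open import Data.Bool using (Bool; true; false)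
open import Data.List using (List; []; _∷_; reverse; map; filter)
open import Data.Vec using (Vec; toList; allFin; lookup)
open import Data.Fin using (Fin)
open import Data.Fin.Subset using (Subset; ⋂; ∣_∣)
open import Data.Fin.Subset.Properties using (_∈?_)
open import Relation.Binary.PropositionalEquality using (_≡_)
import Data.List.Sort

open Data.List.Sort ≤-decTotalOrder using (sort)

-- A set system H = (U, (A_1,...,A_m)) with finite ground set U = Fin n,
-- given as a family A : Fin m → Subset n.  Index i : Fin m stands for the
-- 1-based index (toℕ i + 1); index sets I ⊆ [m] are Subset m.

-- H_I = ⋂_{i ∈ I} A_i  (= U = ⊤ when I = ∅)
H[_] : ∀ {n m} → (Fin m → Subset n) → Subset m → Subset n
H[ A ] I = ⋂ (map A (filter (λ i → i ∈? I) (toList (allFin _))))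

-- lengths of the maximal runs of consecutive elements, scanning the
-- characteristic vector of I from left to right (in order of occurrence)
private
  flush : ℕ → List ℕ → List ℕ
  flush zero    l = l
  flush (suc k) l = suc k ∷ l

  go : ℕ → List Bool → List ℕ
  go k []           = flush k []
  go k (true ∷ bs)  = go (suc k) bs
  go k (false ∷ bs) = flush k (go 0 bs)

runLengths : ∀ {m} → Subset m → List ℕ
runLengths I = go 0 (toList I)

runDecomposition : ∀ {m} → Subset m → List ℕ
runDecomposition I = reverse (sort (runLengths I))

Harmonic : ∀ {n m} → (Fin m → Subset n) → Set
Harmonic {m = m} A =
  (I J : Subset m) → runDecomposition I ≡ runDecomposition J →
  ∣ H[ A ] I ∣ ≡ ∣ H[ A ] J ∣

{-# OPTIONS --safe #-}
-- Only the odd-indexed sets matter.  Every I ⊆ {1, 3, 5, …} has run decomposition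
-- (1, …, 1), so harmonicity makes |H_I| a function of |I| alone.  Inclusion–
-- exclusion then shows that the number of points whose membership pattern on
-- the k = ⌈m/2⌉ odd indices is exactly a given set u also depends only on |u|.
-- A point of A₁ ∩ A₃ ∩ A₅ outside A₇ ∪ A₉ ∪ A₁₁ has such a pattern u with
-- 3 ≤ |u| ≤ k − 3, so all C(k, |u|) ≥ C(k, 3) patterns of size |u| occur, and
-- n ≥ C(k, 3) ≥ 2k(2k − 2) ≥ m(m − 2) once k ≥ 26.
module Submission where

open import Defs
open import Data.Nat using (ℕ; _<_; _≤_; _*_; _∸_)
open import Data.Fin using (Fin; #_; inject≤)
open import Data.Fin.Subset using (Subset; ⊥; _∩_; ∁)
open import Relation.Binary.PropositionalEquality using (_≡_)

open import Algebra.Properties.CommutativeSemigroup using (interchange)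
open import Data.Bool using (Bool; true; false; not; _∧_; _∨_; if_then_else_)
open import Data.Bool.ListAction using (and; all)
open import Data.Bool.Properties using (not-injective)
open import Data.Fin using (zero; suc)
open import Data.Fin.Subset using (⋂; ∣_∣; _∈_)
open import Data.Fin.Subset.Properties
  using (_∈?_; Empty-unique; x∈p∩q⁻; ∣⊥∣≡0; ∣p∣≤n; ∣∁p∣≡n∸∣p∣)
open import Data.List as List using (List; []; _∷_; length; replicate; reverse; filter)
open import Data.Nat using (zero; suc; _+_; z≤n; s≤s; ⌈_/2⌉)
open import Data.Nat.Combinatorics using (_C_; nCk+nC[k+1]≡[n+1]C[k+1]; nC1≡n; nCk≡nC[n∸k])
open import Data.Nat.ListAction using (sum)
open import Data.Nat.Properties
open import Data.Nat.Tactic.RingSolver using (solve-∀)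
open import Data.Product using (∃; _×_; _,_)
open import Data.Vec using (Vec; []; _∷_; lookup; map; tabulate; toList; allFin; _[_]≔_)
open import Data.Vec.Properties using (lookup-map; lookup-replicate; lookup-zipWith; length-toList; []=⇒lookup)
open import Function using (_∘_; id)
open import Relation.Nullary using (¬_; does)
open import Relation.Binary.PropositionalEquality
  using (refl; sym; trans; cong; cong₂; subst; module ≡-Reasoning)
import Data.List.Sort
open Data.List.Sort ≤-decTotalOrder using (sort)

data Cond : Set where
  present absent free : Cond

Pattern : ℕ → Set
Pattern = Vec Cond

satisfies : Cond → Bool → Bool
satisfies present b = b
satisfies absent  b = not b
satisfies free    _ = true

matches : ∀ {k} → Pattern k → Subset k → Bool
matches []      []      = true
matches (c ∷ t) (b ∷ v) = satisfies c b ∧ matches t v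

atLeast : ∀ {k} → Subset k → Pattern k
atLeast = map λ b → if b then present else free

exactly : ∀ {k} → Subset k → Pattern k
exactly = map λ b → if b then present else absent

hit : ∀ {k} → Pattern k → Subset k → ℕ
hit t v = if matches t v then 1 else 0

count : ∀ {k} → Pattern k → List (Subset k) → ℕ
count t = sum ∘ List.map (hit t)

#present : ∀ {k} → Pattern k → ℕ
#present []            = 0
#present (present ∷ t) = suc (#present t)
#present (absent  ∷ t) = #present t
#present (free    ∷ t) = #present t

#absent : ∀ {k} → Pattern k → ℕ
#absent []            = 0
#absent (present ∷ t) = #absent t
#absent (absent  ∷ t) = suc (#absent t)
#absent (free    ∷ t) = #absent t

WeightDetermined : ∀ {k} → (Subset k → Pattern k) → List (Subset k) → Set
WeightDetermined {k} toPattern vs =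
  (s s′ : Subset k) → ∣ s ∣ ≡ ∣ s′ ∣ → count (toPattern s) vs ≡ count (toPattern s′) vs

hit-relax : ∀ {k} (t : Pattern k) j → lookup t j ≡ absent → ∀ v →
  hit (t [ j ]≔ free) v ≡ hit t v + hit (t [ j ]≔ present) v
hit-relax (absent ∷ t) zero refl (true  ∷ v) = refl
hit-relax (absent ∷ t) zero refl (false ∷ v) = sym (+-identityʳ _)
hit-relax (c ∷ t) (suc j) eq (b ∷ v) with satisfies c b
... | true  = hit-relax t j eq v
... | false = refl

count-relax : ∀ {k} (t : Pattern k) j → lookup t j ≡ absent → ∀ vs →
  count (t [ j ]≔ free) vs ≡ count t vs + count (t [ j ]≔ present) vs
count-relax t j eq []       = refl
count-relax t j eq (v ∷ vs) =
  trans (cong₂ _+_ (hit-relax t j eq v) (count-relax t j eq vs))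
        (interchange +-commutativeSemigroup (hit t v) (hit (t [ j ]≔ present) v)
                     (count t vs) (count (t [ j ]≔ present) vs))

#absent-relax : ∀ {k} (t : Pattern k) j → lookup t j ≡ absent →
  suc (#absent (t [ j ]≔ free)) ≡ #absent t
#absent-relax (absent  ∷ t) zero    refl = refl
#absent-relax (present ∷ t) (suc j) eq   = #absent-relax t j eq
#absent-relax (absent  ∷ t) (suc j) eq   = cong suc (#absent-relax t j eq)
#absent-relax (free    ∷ t) (suc j) eq   = #absent-relax t j eq

#absent-fill : ∀ {k} (t : Pattern k) j → lookup t j ≡ absent →
  suc (#absent (t [ j ]≔ present)) ≡ #absent t
#absent-fill (absent  ∷ t) zero    refl = refl
#absent-fill (present ∷ t) (suc j) eq   = #absent-fill t j eq
#absent-fill (absent  ∷ t) (suc j) eq   = cong suc (#absent-fill t j eq)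
#absent-fill (free    ∷ t) (suc j) eq   = #absent-fill t j eq

#present-relax : ∀ {k} (t : Pattern k) j → lookup t j ≡ absent →
  #present (t [ j ]≔ free) ≡ #present t
#present-relax (absent  ∷ t) zero    refl = refl
#present-relax (present ∷ t) (suc j) eq   = cong suc (#present-relax t j eq)
#present-relax (absent  ∷ t) (suc j) eq   = #present-relax t j eq
#present-relax (free    ∷ t) (suc j) eq   = #present-relax t j eq

#present-fill : ∀ {k} (t : Pattern k) j → lookup t j ≡ absent →
  #present (t [ j ]≔ present) ≡ suc (#present t)
#present-fill (absent  ∷ t) zero    refl = refl
#present-fill (present ∷ t) (suc j) eq   = cong suc (#present-fill t j eq)
#present-fill (absent  ∷ t) (suc j) eq   = #present-fill t j eq
#present-fill (free    ∷ t) (suc j) eq   = #present-fill t j eq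

absent-position : ∀ {k a} (t : Pattern k) → #absent t ≡ suc a → ∃ λ j → lookup t j ≡ absent
absent-position (absent  ∷ t) _  = zero , refl
absent-position (present ∷ t) eq with absent-position t eq
... | j , t[j]≡absent = suc j , t[j]≡absent
absent-position (free    ∷ t) eq with absent-position t eq
... | j , t[j]≡absent = suc j , t[j]≡absent

isPresent : Cond → Bool
isPresent present = true
isPresent _       = false

presentSet : ∀ {k} → Pattern k → Subset k
presentSet = map isPresent

atLeast-presentSet : ∀ {k} (t : Pattern k) → #absent t ≡ 0 → atLeast (presentSet t) ≡ t
atLeast-presentSet []            _  = refl
atLeast-presentSet (present ∷ t) eq = cong (present ∷_) (atLeast-presentSet t eq)
atLeast-presentSet (free    ∷ t) eq = cong (free ∷_) (atLeast-presentSet t eq)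

∣presentSet∣ : ∀ {k} (t : Pattern k) → ∣ presentSet t ∣ ≡ #present t
∣presentSet∣ []            = refl
∣presentSet∣ (present ∷ t) = cong suc (∣presentSet∣ t)
∣presentSet∣ (absent  ∷ t) = ∣presentSet∣ t
∣presentSet∣ (free    ∷ t) = ∣presentSet∣ t

-- Inclusion–exclusion, one absent entry at a time: by count-relax, count t is
-- the difference of the counts of two patterns with one absent entry fewer.
count-determined-by-weights : ∀ {k} (vs : List (Subset k)) → WeightDetermined atLeast vs →
  ∀ a (t t′ : Pattern k) → #absent t ≡ a → #absent t′ ≡ a → #present t ≡ #present t′ →
  count t vs ≡ count t′ vs
count-determined-by-weights vs atLeast-det zero t t′ t-abs t′-abs same-present = begin
  count t vs                               ≡⟨ cong (λ u → count u vs) (atLeast-presentSet t t-abs) ⟨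
  count (atLeast (presentSet t)) vs        ≡⟨ atLeast-det (presentSet t) (presentSet t′) same-size ⟩
  count (atLeast (presentSet t′)) vs       ≡⟨ cong (λ u → count u vs) (atLeast-presentSet t′ t′-abs) ⟩
  count t′ vs                              ∎
  where
  open ≡-Reasoning
  same-size : ∣ presentSet t ∣ ≡ ∣ presentSet t′ ∣
  same-size = trans (∣presentSet∣ t) (trans same-present (sym (∣presentSet∣ t′)))
count-determined-by-weights vs atLeast-det (suc a) t t′ t-abs t′-abs same-present
  with absent-position t t-abs | absent-position t′ t′-abs
... | j , t[j] | j′ , t′[j′] =
  +-cancelʳ-≡ (count (t [ j ]≔ present) vs) (count t vs) (count t′ vs) (begin
    count t vs + count (t [ j ]≔ present) vs    ≡⟨ count-relax t j t[j] vs ⟨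
    count (t [ j ]≔ free) vs                    ≡⟨ relaxed-equal ⟩
    count (t′ [ j′ ]≔ free) vs                  ≡⟨ count-relax t′ j′ t′[j′] vs ⟩
    count t′ vs + count (t′ [ j′ ]≔ present) vs ≡⟨ cong (count t′ vs +_) filled-equal ⟨
    count t′ vs + count (t [ j ]≔ present) vs   ∎)
  where
  open ≡-Reasoning
  relaxed-equal : count (t [ j ]≔ free) vs ≡ count (t′ [ j′ ]≔ free) vs
  relaxed-equal = count-determined-by-weights vs atLeast-det a (t [ j ]≔ free) (t′ [ j′ ]≔ free)
    (suc-injective (trans (#absent-relax t j t[j]) t-abs))
    (suc-injective (trans (#absent-relax t′ j′ t′[j′]) t′-abs))
    (trans (#present-relax t j t[j]) (trans same-present (sym (#present-relax t′ j′ t′[j′]))))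
  filled-equal : count (t [ j ]≔ present) vs ≡ count (t′ [ j′ ]≔ present) vs
  filled-equal = count-determined-by-weights vs atLeast-det a (t [ j ]≔ present) (t′ [ j′ ]≔ present)
    (suc-injective (trans (#absent-fill t j t[j]) t-abs))
    (suc-injective (trans (#absent-fill t′ j′ t′[j′]) t′-abs))
    (trans (#present-fill t j t[j]) (trans (cong suc same-present) (sym (#present-fill t′ j′ t′[j′]))))

#present-exactly : ∀ {k} (u : Subset k) → #present (exactly u) ≡ ∣ u ∣
#present-exactly []          = refl
#present-exactly (true  ∷ u) = cong suc (#present-exactly u)
#present-exactly (false ∷ u) = #present-exactly u

#absent-exactly : ∀ {k} (u : Subset k) → #absent (exactly u) ≡ ∣ ∁ u ∣
#absent-exactly []          = refl
#absent-exactly (true  ∷ u) = #absent-exactly u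
#absent-exactly (false ∷ u) = cong suc (#absent-exactly u)

atLeast⇒exactly : ∀ {k} (vs : List (Subset k)) →
  WeightDetermined atLeast vs → WeightDetermined exactly vs
atLeast⇒exactly {k} vs atLeast-det u w ∣u∣≡∣w∣ =
  count-determined-by-weights vs atLeast-det ∣ ∁ u ∣ (exactly u) (exactly w)
    (#absent-exactly u)
    (trans (#absent-exactly w) ∣∁w∣≡∣∁u∣)
    (trans (#present-exactly u) (trans ∣u∣≡∣w∣ (sym (#present-exactly w))))
  where
  ∣∁w∣≡∣∁u∣ : ∣ ∁ w ∣ ≡ ∣ ∁ u ∣
  ∣∁w∣≡∣∁u∣ = trans (∣∁p∣≡n∸∣p∣ w)
    (trans (cong (k ∸_) (sym ∣u∣≡∣w∣)) (sym (∣∁p∣≡n∸∣p∣ u)))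

tailsWhere : ∀ {k} → Cond → List (Subset (suc k)) → List (Subset k)
tailsWhere c []             = []
tailsWhere c ((b ∷ v) ∷ vs) = if satisfies c b then v ∷ tailsWhere c vs else tailsWhere c vs

count-∷ : ∀ {k} c (t : Pattern k) vs → count (c ∷ t) vs ≡ count t (tailsWhere c vs)
count-∷ c t []             = refl
count-∷ c t ((b ∷ v) ∷ vs) with satisfies c b
... | true  = cong (hit t v +_) (count-∷ c t vs)
... | false = count-∷ c t vs

length-tailsWhere : ∀ {k} (vs : List (Subset (suc k))) →
  length vs ≡ length (tailsWhere present vs) + length (tailsWhere absent vs)
length-tailsWhere []                 = refl
length-tailsWhere ((true  ∷ v) ∷ vs) = cong suc (length-tailsWhere vs)
length-tailsWhere ((false ∷ v) ∷ vs) = trans (cong suc (length-tailsWhere vs)) (sym (+-suc _ _))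

hit≤1 : ∀ {k} (t : Pattern k) v → hit t v ≤ 1
hit≤1 t v with matches t v
... | true  = ≤-refl
... | false = z≤n

count≤length : ∀ {k} (t : Pattern k) vs → count t vs ≤ length vs
count≤length t []       = z≤n
count≤length t (v ∷ vs) = +-mono-≤ (hit≤1 t v) (count≤length t vs)

C≤length : ∀ k p (vs : List (Subset k)) →
  (∀ u → ∣ u ∣ ≡ p → 0 < count (exactly u) vs) → k C p ≤ length vs
C≤length k       zero    vs occurs = ≤-trans (occurs ⊥ (∣⊥∣≡0 k)) (count≤length (exactly ⊥) vs)
C≤length zero    (suc p) vs occurs = z≤n
C≤length (suc k) (suc p) vs occurs = begin
  suc k C suc p
    ≡⟨ nCk+nC[k+1]≡[n+1]C[k+1] k p ⟨
  k C p + k C suc p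
    ≤⟨ +-mono-≤ (C≤length k p (tailsWhere present vs) occurs-present)
                (C≤length k (suc p) (tailsWhere absent vs) occurs-absent) ⟩
  length (tailsWhere present vs) + length (tailsWhere absent vs)
    ≡⟨ length-tailsWhere vs ⟨
  length vs ∎
  where
  open ≤-Reasoning
  occurs-present : ∀ u → ∣ u ∣ ≡ p → 0 < count (exactly u) (tailsWhere present vs)
  occurs-present u ∣u∣≡p =
    subst (0 <_) (count-∷ present (exactly u) vs) (occurs (true ∷ u) (cong suc ∣u∣≡p))
  occurs-absent : ∀ u → ∣ u ∣ ≡ suc p → 0 < count (exactly u) (tailsWhere absent vs)
  occurs-absent u ∣u∣≡1+p =
    subst (0 <_) (count-∷ absent (exactly u) vs) (occurs (false ∷ u) ∣u∣≡1+p)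

matches-self : ∀ {k} (v : Subset k) → matches (exactly v) v ≡ true
matches-self []          = refl
matches-self (true  ∷ v) = matches-self v
matches-self (false ∷ v) = matches-self v

C∣v∣≤length : ∀ {k} (vs : List (Subset k)) → WeightDetermined exactly vs →
  ∀ v → 0 < count (exactly v) vs → k C ∣ v ∣ ≤ length vs
C∣v∣≤length {k} vs exactly-det v v-occurs = C≤length k ∣ v ∣ vs λ u ∣u∣≡∣v∣ →
  subst (0 <_) (exactly-det v u (sym ∣u∣≡∣v∣)) v-occurs

2*[2+j]C2 : ∀ j → 2 * ((2 + j) C 2) ≡ (1 + j) * (2 + j)
2*[2+j]C2 zero    = refl
2*[2+j]C2 (suc j) = begin
  2 * ((3 + j) C 2)                     ≡⟨ cong (2 *_) (nCk+nC[k+1]≡[n+1]C[k+1] (2 + j) 1) ⟨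
  2 * ((2 + j) C 1 + (2 + j) C 2)       ≡⟨ *-distribˡ-+ 2 ((2 + j) C 1) ((2 + j) C 2) ⟩
  2 * ((2 + j) C 1) + 2 * ((2 + j) C 2) ≡⟨ cong₂ (λ x y → 2 * x + y) (nC1≡n (2 + j)) (2*[2+j]C2 j) ⟩
  2 * (2 + j) + (1 + j) * (2 + j)       ≡⟨ step j ⟩
  (2 + j) * (3 + j)                     ∎
  where
  open ≡-Reasoning
  step : ∀ j → 2 * (2 + j) + (1 + j) * (2 + j) ≡ (2 + j) * (3 + j)
  step = solve-∀

6*[3+j]C3 : ∀ j → 6 * ((3 + j) C 3) ≡ (1 + j) * (2 + j) * (3 + j)
6*[3+j]C3 zero    = refl
6*[3+j]C3 (suc j) = begin
  6 * ((4 + j) C 3)                     ≡⟨ cong (6 *_) (nCk+nC[k+1]≡[n+1]C[k+1] (3 + j) 2) ⟨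
  6 * ((3 + j) C 2 + (3 + j) C 3)       ≡⟨ *-distribˡ-+ 6 ((3 + j) C 2) ((3 + j) C 3) ⟩
  6 * ((3 + j) C 2) + 6 * ((3 + j) C 3) ≡⟨ cong (_+ 6 * ((3 + j) C 3)) (*-assoc 3 2 ((3 + j) C 2)) ⟩
  3 * (2 * ((3 + j) C 2)) + 6 * ((3 + j) C 3)
    ≡⟨ cong₂ (λ x y → 3 * x + y) (2*[2+j]C2 (suc j)) (6*[3+j]C3 j) ⟩
  3 * ((2 + j) * (3 + j)) + (1 + j) * (2 + j) * (3 + j)
    ≡⟨ step j ⟩
  (2 + j) * (3 + j) * (4 + j)           ∎
  where
  open ≡-Reasoning
  step : ∀ j → 3 * ((2 + j) * (3 + j)) + (1 + j) * (2 + j) * (3 + j) ≡ (2 + j) * (3 + j) * (4 + j)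
  step = solve-∀

C2≤C3 : ∀ {n} → 5 ≤ n → n C 2 ≤ n C 3
C2≤C3 5≤n with m≤n⇒∃[o]m+o≡n 5≤n
... | i , refl = *-cancelˡ-≤ 6 (begin
  6 * ((5 + i) C 2)                           ≡⟨ *-assoc 3 2 ((5 + i) C 2) ⟩
  3 * (2 * ((5 + i) C 2))                     ≡⟨ cong (3 *_) (2*[2+j]C2 (3 + i)) ⟩
  3 * ((4 + i) * (5 + i))                     ≤⟨ *-monoˡ-≤ ((4 + i) * (5 + i)) (m≤m+n 3 i) ⟩
  (3 + i) * ((4 + i) * (5 + i))               ≡⟨ *-assoc (3 + i) (4 + i) (5 + i) ⟨
  (3 + i) * (4 + i) * (5 + i)                 ≡⟨ 6*[3+j]C3 (2 + i) ⟨
  6 * ((5 + i) C 3)                           ∎)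
  where open ≤-Reasoning

[p+q]C3≤[p+q]Cp : ∀ {p q} → 3 ≤ p → 3 ≤ q → (p + q) C 3 ≤ (p + q) C p
[p+q]C3≤[p+q]Cp 3≤p 3≤q with m≤n⇒∃[o]m+o≡n 3≤p | m≤n⇒∃[o]m+o≡n 3≤q
... | a , refl | b , refl = shifted a b
  where
  shifted : ∀ a b → (3 + a + (3 + b)) C 3 ≤ (3 + a + (3 + b)) C (3 + a)
  shifted zero    b       = ≤-refl
  shifted (suc a) zero    = ≤-reflexive (begin
    n C 3             ≡⟨ cong (n C_) (m+n∸m≡n (4 + a) 3) ⟨
    n C (n ∸ (4 + a)) ≡⟨ nCk≡nC[n∸k] (m≤m+n (4 + a) 3) ⟨
    n C (4 + a)       ∎)
    where
    open ≡-Reasoning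
    n = 4 + a + 3
  shifted (suc a) (suc b) = begin
    suc n C 3                 ≡⟨ nCk+nC[k+1]≡[n+1]C[k+1] n 2 ⟨
    n C 2 + n C 3             ≤⟨ +-monoˡ-≤ (n C 3) (C2≤C3 (<⇒≤ 6≤n)) ⟩
    n C 3 + n C 3             ≤⟨ +-mono-≤ (shifted a (suc b)) shifted-suc-a ⟩
    n C (3 + a) + n C (4 + a) ≡⟨ nCk+nC[k+1]≡[n+1]C[k+1] n (3 + a) ⟩
    suc n C (4 + a)           ∎
    where
    open ≤-Reasoning
    n = 3 + a + (4 + b)
    6≤n : 6 ≤ n
    6≤n = +-mono-≤ (m≤m+n 3 a) (m≤m+n 3 (suc b))
    shifted-suc-a : n C 3 ≤ n C (4 + a)
    shifted-suc-a = subst (λ x → x C 3 ≤ x C (4 + a)) (sym (+-suc (3 + a) (3 + b))) (shifted (suc a) b)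

-- 6 · C(k, 3) = (k − 2)(k − 1)k and 6 · 2k(2k − 2) = 24(k − 1)k, hence the bound 26.
-- Splitting 26 ≤ k with a with-abstraction instead of let would make Agda
-- normalise k C 3 symbolically, which exhausts memory.
2k*[2k∸2]≤kC3 : ∀ {k} → 26 ≤ k → (k + k) * (k + k ∸ 2) ≤ k C 3
2k*[2k∸2]≤kC3 26≤k =
  let c , 26+c≡k = m≤n⇒∃[o]m+o≡n 26≤k
  in subst (λ k → (k + k) * (k + k ∸ 2) ≤ k C 3) 26+c≡k (bound c)
  where
  bound : ∀ c → (26 + c + (26 + c)) * (24 + c + (26 + c)) ≤ (26 + c) C 3
  bound c = *-cancelˡ-≤ 6 (begin
    6 * ((26 + c + (26 + c)) * (24 + c + (26 + c))) ≡⟨ expand c ⟩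
    24 * ((25 + c) * (26 + c))                        ≤⟨ *-monoˡ-≤ ((25 + c) * (26 + c)) (m≤m+n 24 c) ⟩
    (24 + c) * ((25 + c) * (26 + c))                  ≡⟨ *-assoc (24 + c) (25 + c) (26 + c) ⟨
    (24 + c) * (25 + c) * (26 + c)                    ≡⟨ 6*[3+j]C3 (23 + c) ⟨
    6 * ((26 + c) C 3)                                ∎)
    where
    open ≤-Reasoning
    expand : ∀ c → 6 * ((26 + c + (26 + c)) * (24 + c + (26 + c))) ≡ 24 * ((25 + c) * (26 + c))
    expand = solve-∀

m≤⌈m/2⌉+⌈m/2⌉ : ∀ m → m ≤ ⌈ m /2⌉ + ⌈ m /2⌉
m≤⌈m/2⌉+⌈m/2⌉ m =
  ≤-trans (≤-reflexive (sym (⌊n/2⌋+⌈n/2⌉≡n m))) (+-monoˡ-≤ ⌈ m /2⌉ (⌊n/2⌋≤⌈n/2⌉ m))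

column : ∀ {n m} → (Fin m → Subset n) → Fin n → Subset m
column A x = tabulate λ i → lookup (A i) x

lookup-⋂-filter : ∀ {n m} (A : Fin m → Subset n) I x (is : List (Fin m)) →
  lookup (⋂ (List.map A (filter (_∈? I) is))) x ≡ all (λ i → not (does (i ∈? I)) ∨ lookup (A i) x) is
lookup-⋂-filter A I x []       = lookup-replicate x true
lookup-⋂-filter A I x (i ∷ is) with does (i ∈? I)
... | true  = trans (lookup-zipWith _∧_ x (A i) _) (cong (lookup (A i) x ∧_) (lookup-⋂-filter A I x is))
... | false = lookup-⋂-filter A I x is

all-tabulate : ∀ {A : Set} {k} (g : A → Bool) (h : Fin k → A) →
  all g (toList (tabulate h)) ≡ and (toList (tabulate (g ∘ h)))
all-tabulate {k = zero}  g h = refl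
all-tabulate {k = suc k} g h = cong (g (h zero) ∧_) (all-tabulate g (h ∘ suc))

matches-atLeast-tabulate : ∀ {k} (I : Subset k) (f : Fin k → Bool) →
  matches (atLeast I) (tabulate f) ≡ and (toList (tabulate λ i → not (does (i ∈? I)) ∨ f i))
matches-atLeast-tabulate []          f = refl
matches-atLeast-tabulate (true  ∷ I) f = cong (f zero ∧_) (matches-atLeast-tabulate I (f ∘ suc))
matches-atLeast-tabulate (false ∷ I) f = matches-atLeast-tabulate I (f ∘ suc)

lookup-H[] : ∀ {n m} (A : Fin m → Subset n) I x → lookup (H[ A ] I) x ≡ matches (atLeast I) (column A x)
lookup-H[] {m = m} A I x = begin
  lookup (H[ A ] I) x                      ≡⟨ lookup-⋂-filter A I x (toList (allFin m)) ⟩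
  all g (toList (allFin m))                ≡⟨ all-tabulate g id ⟩
  and (toList (tabulate g))                ≡⟨ matches-atLeast-tabulate I (λ i → lookup (A i) x) ⟨
  matches (atLeast I) (column A x)         ∎
  where
  open ≡-Reasoning
  g : Fin m → Bool
  g i = not (does (i ∈? I)) ∨ lookup (A i) x

∣p∣≡count : ∀ {n k} (p : Subset n) (t : Pattern k) (f : Fin n → Subset k) →
  (∀ x → lookup p x ≡ matches t (f x)) → ∣ p ∣ ≡ count t (toList (tabulate f))
∣p∣≡count []      t f _        = refl
∣p∣≡count (b ∷ p) t f p≡t[f] =
  trans (∣b∷p∣ b) (cong₂ _+_ (cong (λ b → if b then 1 else 0) (p≡t[f] zero))
                              (∣p∣≡count p t (f ∘ suc) (p≡t[f] ∘ suc)))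
  where
  ∣b∷p∣ : ∀ b → ∣ b ∷ p ∣ ≡ (if b then 1 else 0) + ∣ p ∣
  ∣b∷p∣ true  = refl
  ∣b∷p∣ false = refl

0<count-tabulate : ∀ {n k} (t : Pattern k) (f : Fin n → Subset k) x →
  matches t (f x) ≡ true → 0 < count t (toList (tabulate f))
0<count-tabulate t f zero    eq =
  ≤-trans (subst (λ b → 0 < (if b then 1 else 0)) (sym eq) ≤-refl) (m≤m+n _ _)
0<count-tabulate t f (suc x) eq =
  ≤-trans (0<count-tabulate t (f ∘ suc) x eq) (m≤n+m _ (hit t (f zero)))

-- The entries at the 1-based odd positions 1, 3, 5, … (0-based 0, 2, 4, …).
odds : ∀ {A : Set} {m} → Vec A m → Vec A ⌈ m /2⌉
odds {m = zero}        []          = []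
odds {m = suc zero}    (a ∷ [])    = a ∷ []
odds {m = suc (suc m)} (a ∷ _ ∷ v) = a ∷ odds v

onOdds : ∀ {m} → Subset ⌈ m /2⌉ → Subset m
onOdds {zero}        []       = []
onOdds {suc zero}    (b ∷ []) = b ∷ []
onOdds {suc (suc m)} (b ∷ s)  = b ∷ false ∷ onOdds s

runLengths-onOdds : ∀ {m} (s : Subset ⌈ m /2⌉) → runLengths (onOdds {m} s) ≡ replicate ∣ s ∣ 1
runLengths-onOdds {zero}        []           = refl
runLengths-onOdds {suc zero}    (true  ∷ []) = refl
runLengths-onOdds {suc zero}    (false ∷ []) = refl
runLengths-onOdds {suc (suc m)} (true  ∷ s)  = cong (1 ∷_) (runLengths-onOdds {m} s)
runLengths-onOdds {suc (suc m)} (false ∷ s)  = runLengths-onOdds {m} s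

matches-atLeast-onOdds : ∀ {m} (s : Subset ⌈ m /2⌉) (v : Subset m) →
  matches (atLeast (onOdds s)) v ≡ matches (atLeast s) (odds v)
matches-atLeast-onOdds {zero}        []       []          = refl
matches-atLeast-onOdds {suc zero}    (b ∷ []) (c ∷ [])    = refl
matches-atLeast-onOdds {suc (suc m)} (b ∷ s)  (c ∷ _ ∷ v) =
  cong (satisfies (if b then present else free) c ∧_) (matches-atLeast-onOdds s v)

∣p∣+∣∁p∣≡n : ∀ {n} (p : Subset n) → ∣ p ∣ + ∣ ∁ p ∣ ≡ n
∣p∣+∣∁p∣≡n p = trans (cong (∣ p ∣ +_) (∣∁p∣≡n∸∣p∣ p)) (m+[n∸m]≡n (∣p∣≤n p))

oddColumns : ∀ {n m} → (Fin m → Subset n) → List (Subset ⌈ m /2⌉)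
oddColumns A = toList (tabulate (odds ∘ column A))

harmonic⇒atLeast-weightDetermined : ∀ {n m} (A : Fin m → Subset n) → Harmonic A →
  WeightDetermined atLeast (oddColumns A)
harmonic⇒atLeast-weightDetermined {m = m} A harmonic s s′ ∣s∣≡∣s′∣ = begin
  count (atLeast s) (oddColumns A)  ≡⟨ ∣H[onOdds]∣≡count s ⟨
  ∣ H[ A ] (onOdds s) ∣             ≡⟨ harmonic (onOdds s) (onOdds s′) (cong (reverse ∘ sort) same-runs) ⟩
  ∣ H[ A ] (onOdds s′) ∣            ≡⟨ ∣H[onOdds]∣≡count s′ ⟩
  count (atLeast s′) (oddColumns A) ∎
  where
  open ≡-Reasoning
  ∣H[onOdds]∣≡count : ∀ s → ∣ H[ A ] (onOdds s) ∣ ≡ count (atLeast s) (oddColumns A)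
  ∣H[onOdds]∣≡count s = ∣p∣≡count (H[ A ] (onOdds s)) (atLeast s) (odds ∘ column A) λ x →
    trans (lookup-H[] A (onOdds s) x) (matches-atLeast-onOdds s (column A x))
  same-runs : runLengths (onOdds {m} s) ≡ runLengths (onOdds {m} s′)
  same-runs = trans (runLengths-onOdds s)
    (trans (cong (λ r → replicate r 1) ∣s∣≡∣s′∣) (sym (runLengths-onOdds s′)))

ThreeInThreeOut : ∀ {k} → Subset k → Set
ThreeInThreeOut v = 3 ≤ ∣ v ∣ × 3 ≤ ∣ ∁ v ∣

odd-column-not-three-in-three-out : ∀ {n m} (A : Fin m → Subset n) → Harmonic A →
  n < m * (m ∸ 2) → 51 ≤ m → ∀ x → ¬ ThreeInThreeOut (odds (column A x))
odd-column-not-three-in-three-out {n} {m} A harmonic n<m[m∸2] 51≤m x (3≤∣v∣ , 3≤∣∁v∣) =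
  <-irrefl refl (begin-strict
    n                     <⟨ n<m[m∸2] ⟩
    m * (m ∸ 2)           ≤⟨ *-mono-≤ m≤k+k (∸-monoˡ-≤ 2 m≤k+k) ⟩
    (k + k) * (k + k ∸ 2) ≤⟨ 2k*[2k∸2]≤kC3 (⌈n/2⌉-mono 51≤m) ⟩
    k C 3                 ≤⟨ kC3≤kC∣v∣ ⟩
    k C ∣ v ∣             ≤⟨ C∣v∣≤length (oddColumns A) exactly-det v v-occurs ⟩
    length (oddColumns A) ≡⟨ length-toList (tabulate (odds ∘ column A)) ⟩
    n                     ∎)
  where
  open ≤-Reasoning
  k : ℕ
  k = ⌈ m /2⌉
  v : Subset k
  v = odds (column A x)
  m≤k+k : m ≤ k + k
  m≤k+k = m≤⌈m/2⌉+⌈m/2⌉ m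
  kC3≤kC∣v∣ : k C 3 ≤ k C ∣ v ∣
  kC3≤kC∣v∣ =
    subst (λ k → k C 3 ≤ k C ∣ v ∣) (∣p∣+∣∁p∣≡n v) ([p+q]C3≤[p+q]Cp 3≤∣v∣ 3≤∣∁v∣)
  exactly-det : WeightDetermined exactly (oddColumns A)
  exactly-det = atLeast⇒exactly (oddColumns A) (harmonic⇒atLeast-weightDetermined A harmonic)
  v-occurs : 0 < count (exactly v) (oddColumns A)
  v-occurs = 0<count-tabulate (exactly v) (odds ∘ column A) x (matches-self v)

∈⇒lookup≡true : ∀ {n} {x : Fin n} {p : Subset n} → x ∈ p → lookup p x ≡ true
∈⇒lookup≡true = []=⇒lookup

∈∁⇒lookup≡false : ∀ {n} {x : Fin n} {p : Subset n} → x ∈ ∁ p → lookup p x ≡ false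
∈∁⇒lookup≡false {x = x} {p} x∈∁p =
  not-injective (trans (sym (lookup-map x not p)) ([]=⇒lookup x∈∁p))

three-in-three-out : ∀ {k} (v : Subset (6 + k)) →
  lookup v (# 0) ≡ true → lookup v (# 1) ≡ true → lookup v (# 2) ≡ true →
  lookup v (# 3) ≡ false → lookup v (# 4) ≡ false → lookup v (# 5) ≡ false →
  ThreeInThreeOut v
three-in-three-out (_ ∷ _ ∷ _ ∷ _ ∷ _ ∷ _ ∷ _) refl refl refl refl refl refl =
  s≤s (s≤s (s≤s z≤n)) , s≤s (s≤s (s≤s z≤n))

∈A₁A₃A₅∖A₇A₉A₁₁⇒three-in-three-out : ∀ {n m} (A : Fin (12 + m) → Subset n) {x} →
  x ∈ A (# 0) ∩ A (# 2) ∩ A (# 4) ∩ ∁ (A (# 6)) ∩ ∁ (A (# 8)) ∩ ∁ (A (# 10)) →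
  ThreeInThreeOut (odds (column A x))
∈A₁A₃A₅∖A₇A₉A₁₁⇒three-in-three-out A {x} x∈S =
  let x∈A₁ , x∈S₃  = x∈p∩q⁻ _ _ x∈S
      x∈A₃ , x∈S₅  = x∈p∩q⁻ _ _ x∈S₃
      x∈A₅ , x∈S₇  = x∈p∩q⁻ _ _ x∈S₅
      x∉A₇ , x∈S₉  = x∈p∩q⁻ _ _ x∈S₇
      x∉A₉ , x∉A₁₁ = x∈p∩q⁻ _ _ x∈S₉
  in three-in-three-out (odds (column A x))
       (∈⇒lookup≡true x∈A₁) (∈⇒lookup≡true x∈A₃) (∈⇒lookup≡true x∈A₅)
       (∈∁⇒lookup≡false x∉A₇) (∈∁⇒lookup≡false x∉A₉) (∈∁⇒lookup≡false x∉A₁₁)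

proposition4p20 : (n m : ℕ) (A : Fin m → Subset n) → Harmonic A →
    n < m * (m ∸ 2) → (h : 51 ≤ m) →
    (A (inject≤ (# 0) h) ∩ A (inject≤ (# 2) h) ∩ A (inject≤ (# 4) h)
      ∩ ∁ (A (inject≤ (# 6) h)) ∩ ∁ (A (inject≤ (# 8) h))
      ∩ ∁ (A (inject≤ (# 10) h))) ≡ ⊥
-- Exposing twelve successors in m makes inject≤ (# i) h compute to # i.
proposition4p20 n m A harmonic n<m[m∸2]
  h@(s≤s (s≤s (s≤s (s≤s (s≤s (s≤s (s≤s (s≤s (s≤s (s≤s (s≤s (s≤s _)))))))))))) =
  Empty-unique λ (x , x∈S) →
    odd-column-not-three-in-three-out A harmonic n<m[m∸2] h x
      (∈A₁A₃A₅∖A₇A₉A₁₁⇒three-in-three-out A x∈S)
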